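{- Let $T_1,T_2$ be rooted trees on the node set $[n]$. For every pair $(u,v)$ with $\mathsf{level}_{T_1}(u)=\mathsf{level}_{T_2}(v)$ and $T_1|u\equiv T_2|v$, let $G(u,v)$ be the distance graph defined below. Then the total weight of all non-special edges, summed over all these graphs $G(u,v)$, is $\mathcal{O}(n\log n)$.
   Context: Nodes of $T_1,T_2$ are labelled by distinct labels from $[n]$ and identified with them. $T|u$ is the subtree of $T$ rooted at $u$, $\mathsf{children}_T(u)$ the set of children of $u$, $\mathsf{level}_T(u)$ the depth of $u$ (root at level $0$). $T_1|x\equiv T_2|y$ means the two rooted subtrees are isomorphic as unlabelled rooted trees. For $x\in T_1$, $y\in T_2$, let $\gamma(x,y)=0$ if $T_1|x\not\equiv T_2|y$, and otherwise $\gamma(x,y)$ is the maximum, over all isomorphisms $\mu$ from $T_1|x$ to $T_2|y$ (bijections on nodes preserving the parent relation and mapping $x$ to $y$), of the number of nodes $w$ with $\mu(w)=w$. A heavy path decomposition is fixed in each tree: every non-leaf node $u$ has a heavy child, which is a child whose subtree has maximum size, with ties resolved so that whenever $T_1|u\equiv T_2|v$, the heavy child $u'$ of $u$ in $T_1$ and the heavy child $v'$ of $v$ in $T_2$ satisfy $T_1|u'\equiv T_2|v'$. The distance graph $G(u,v)$ is the weighted bipartite graph with sides $\mathsf{children}_{T_1}(u)$ and $\mathsf{children}_{T_2}(v)$, having an edge between $u'$ and $v'$ of weight $\gamma(u',v')$ if and only if $T_1|u'\equiv T_2|v'$ and $\gamma(u',v')>0$. The edge (if it exists) between the heavy child of $u$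 and the heavy child of $v$ is called special; all other edges are non-special. -}

module Defs where

import Data.Nat
open import Data.Nat using (ℕ; zero; suc; _+_; _≤_; _<_; _<?_)
open import Data.Fin using (Fin)
open import Data.Fin.Properties using (_≟_)
open import Data.Nat.ListAction using (sum)
open import Data.List using (List; upTo; map; filter; length; allFin)
open import Data.List.Relation.Unary.Any using (Any; any?)
open import Data.Product using (Σ; _×_; _,_; ∃-syntax)
open import Data.Sum using (_⊎_)
open import Function using (_∘_)
open import Relation.Binary.PropositionalEquality using (_≡_; _≢_)
open import Relation.Nullary using (¬_; Dec; yes; no)
open import Relation.Nullary.Decidable using (_×-dec_; ¬?)

iter : {A : Set} → (A → A) → ℕ → A → A
iter f zero    a = a
iter f (suc k) a = f (iter f k a)

-- These axioms force every node to reach the root by following parents (acyclicity).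
record RTree (n : ℕ) : Set where
  field
    root       : Fin n
    parent     : Fin n → Fin n
    depth      : Fin n → ℕ
    parent-root : parent root ≡ root
    depth-root : depth root ≡ 0
    depth-step : ∀ u → u ≢ root → depth u ≡ suc (depth (parent u))
open RTree public

module _ {n : ℕ} (T : RTree n) where
  level : Fin n → ℕ
  level = depth T

  IsChild : Fin n → Fin n → Set
  IsChild u w = (w ≢ root T) × (parent T w ≡ u)

  isChild? : ∀ u w → Dec (IsChild u w)
  isChild? u w = ¬? (w ≟ root T) ×-dec (parent T w ≟ u)

  -- w lies in T|u, i.e. u is w itself or an ancestor of w:
  -- u = parent^k(w) for some 0 ≤ k ≤ level(w)
  InSub : Fin n → Fin n → Set
  InSub u w = Any (λ k → iter (parent T) k w ≡ u) (upTo (suc (depth T w)))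

  inSub? : ∀ u w → Dec (InSub u w)
  inSub? u w = any? (λ k → iter (parent T) k w ≟ u) (upTo (suc (depth T w)))

  size : Fin n → ℕ
  size u = length (filter (inSub? u) (allFin n))

  -- h is a heavy-child choice: for every non-leaf u, h u is a child of u whose
  -- subtree has maximum size among the children of u (h is arbitrary on leaves)
  IsHeavyChoice : (Fin n → Fin n) → Set
  IsHeavyChoice h = ∀ u c → IsChild u c → IsChild u (h u) × (size c ≤ size (h u))

module _ {n : ℕ} (T₁ T₂ : RTree n) where
  record IsIso (x y : Fin n) (μ : Fin n → Fin n) : Set where
    field
      root-map : μ x ≡ y
      into     : ∀ w → InSub T₁ x w → InSub T₂ y (μ w)
      inj      : ∀ w w′ → InSub T₁ x w → InSub T₁ x w′ → μ w ≡ μ w′ → w ≡ w′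
      surj     : ∀ w′ → InSub T₂ y w′ → ∃[ w ] (InSub T₁ x w × μ w ≡ w′)
      par      : ∀ w → InSub T₁ x w → w ≢ x → parent T₂ (μ w) ≡ μ (parent T₁ w)

  Iso : Fin n → Fin n → Set
  Iso x y = Σ (Fin n → Fin n) (IsIso x y)

  fixCount : Fin n → (Fin n → Fin n) → ℕ
  fixCount x μ = length (filter (λ w → inSub? T₁ x w ×-dec (μ w ≟ w)) (allFin n))

  IsGamma : (Fin n → Fin n → ℕ) → Set
  IsGamma g = ∀ x y →
      (¬ Iso x y → g x y ≡ 0)
    × (Iso x y →
         (∃[ μ ] (IsIso x y μ × fixCount x μ ≡ g x y))
       × (∀ μ → IsIso x y μ → fixCount x μ ≤ g x y))

  HeavyCompatible : (Fin n → Fin n) → (Fin n → Fin n) → Set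
  HeavyCompatible h₁ h₂ = ∀ u v → Iso u v → (∃[ c ] IsChild T₁ u c) → Iso (h₁ u) (h₂ v)

ifDec : {P : Set} → Dec P → ℕ → ℕ
ifDec (yes _) m = m
ifDec (no _)  _ = 0

sumFin : (n : ℕ) → (Fin n → ℕ) → ℕ
sumFin n f = sum (map f (allFin n))

module _ {n : ℕ} (T₁ T₂ : RTree n)
         (iso? : ∀ x y → Dec (Iso T₁ T₂ x y))
         (γ : Fin n → Fin n → ℕ)
         (h₁ h₂ : Fin n → Fin n) where
  nonSpecialWeight : Fin n → Fin n → ℕ
  nonSpecialWeight u v =
    sumFin n λ u′ → sumFin n λ v′ →
      ifDec (isChild? T₁ u u′ ×-dec isChild? T₂ v v′ ×-dec iso? u′ v′
             ×-dec (0 <? γ u′ v′) ×-dec ¬? ((u′ ≟ h₁ u) ×-dec (v′ ≟ h₂ v)))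
            (γ u′ v′)

  totalNonSpecial : ℕ
  totalNonSpecial =
    sumFin n λ u → sumFin n λ v →
      ifDec (Data.Nat._≟_ (level T₁ u) (level T₂ v) ×-dec iso? u v)
            (nonSpecialWeight u v)

module Submission where

-- 1. An isomorphism T₁|u′ → T₂|v′ can only fix nodes lying in both subtrees, so
--    γ(u′,v′) ≤ |T₁|u′ ∩ T₂|v′|.
-- 2. For a non-special edge (u′,v′) at least one endpoint is a light child (not the heavy
--    child of its parent).  Each common node w of T₁|u′ and T₂|v′ is charged to that light
--    endpoint, which is a light ancestor of w in its own tree.
-- 3. Conversely, given w and a light ancestor a′ of w in one tree, the rest of the charged
--    edge is determined: the other endpoint is the ancestor of w at the same depth in the
--    other tree, and u, v are the parents.  So w receives at most (number of light
--    ancestors of w) charges from each tree.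
-- 4. Heavy-path lemma: a light child has at most half the size of its parent, so a node
--    with L light ancestors satisfies 2^L ≤ n, i.e. L ≤ ⌊log₂ n⌋.
-- Summing over all n nodes w and both trees gives the bound with C = 2 (and N = 0).

open import Defs
open import Data.Nat using (ℕ; zero; suc; _≤_; _<_; _*_; _+_; _∸_; _^_; z≤n; s≤s)
import Data.Nat as ℕ
open import Data.Nat.Properties
  using ( +-0-commutativeMonoid; ≤-refl; ≤-reflexive; ≤-trans; +-mono-≤; +-monoʳ-≤
        ; *-monoˡ-≤; *-monoʳ-≤; ^-monoʳ-≤; m≤m+n; m≤n+m; n≤1+n; n≤0⇒n≡0
        ; +-identityʳ; *-identityʳ; *-zeroʳ; +-suc; +-cancelʳ-<; m+n∸m≡n
        ; ^-distribˡ-+-*; *-comm; *-assoc; ≤-pred; <⇒≢; module ≤-Reasoning )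
import Data.Nat.Properties as ℕₚ
open import Data.Nat.Logarithm using (⌊log₂_⌋; ⌊log₂⌋-mono-≤; ⌊log₂[2^n]⌋≡n)
open import Data.Nat.ListAction using () renaming (sum to sumList)
open import Data.Fin using (Fin; zero; suc)
open import Data.Fin.Properties using (_≟_; suc-injective)
open import Data.List using ([]; _∷_; map; filter; length; allFin; tabulate)
open import Data.List.Properties using (map-tabulate; length-filter; length-tabulate)
open import Data.List.Relation.Unary.Any.Properties using (applyUpTo⁺; applyUpTo⁻)
open import Data.Product using (_×_; _,_; ∃-syntax; proj₁; proj₂)
open import Data.Empty using (⊥-elim)
open import Function using (_∘_; id)
open import Relation.Binary.PropositionalEquality
open import Relation.Nullary using (¬_; Dec; yes; no)
open import Relation.Nullary.Decidable using (_×-dec_; ¬?)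
open import Algebra.Properties.CommutativeMonoid.Sum +-0-commutativeMonoid
  using (sum-syntax; ∑-distrib-+; ∑-comm; sum-cong-≗)

ifDec-yes : ∀ {P : Set} (p : Dec P) → P → ∀ m → ifDec p m ≡ m
ifDec-yes (yes _) _ m = refl
ifDec-yes (no ¬p) x m = ⊥-elim (¬p x)

ifDec-mono : ∀ {P Q : Set} (p : Dec P) (q : Dec Q) → (P → Q) → ∀ m → ifDec p m ≤ ifDec q m
ifDec-mono (yes x) q f m = ≤-reflexive (sym (ifDec-yes q (f x) m))
ifDec-mono (no _)  q f m = z≤n

ifDec-elim : ∀ {P : Set} (p : Dec P) {m k} → (P → m ≤ k) → ifDec p m ≤ k
ifDec-elim (yes x) f = f x
ifDec-elim (no _)  f = z≤n

sumFin≡∑ : ∀ n (f : Fin n → ℕ) → sumFin n f ≡ ∑[ i < n ] f i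
sumFin≡∑ zero    f = refl
sumFin≡∑ (suc n) f = cong (f zero +_) (begin
  sumList (map f (tabulate suc))   ≡⟨ cong sumList (map-tabulate suc f) ⟩
  sumList (tabulate (f ∘ suc))     ≡⟨ cong sumList (map-tabulate id (f ∘ suc)) ⟨
  sumFin n (f ∘ suc)               ≡⟨ sumFin≡∑ n (f ∘ suc) ⟩
  ∑[ i < n ] f (suc i)             ∎)
  where open ≡-Reasoning

∑-mono-≤ : ∀ {n} {f g : Fin n → ℕ} → (∀ i → f i ≤ g i) → ∑[ i < n ] f i ≤ ∑[ i < n ] g i
∑-mono-≤ {zero}  h = z≤n
∑-mono-≤ {suc n} h = +-mono-≤ (h zero) (∑-mono-≤ (h ∘ suc))

sumFin-≤ : ∀ n {f g : Fin n → ℕ} → (∀ i → f i ≤ g i) → sumFin n f ≤ ∑[ i < n ] g i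
sumFin-≤ n {f} h = subst (_≤ _) (sym (sumFin≡∑ n f)) (∑-mono-≤ h)

∑-bounded : ∀ {n} {f : Fin n → ℕ} c → (∀ i → f i ≤ c) → ∑[ i < n ] f i ≤ n * c
∑-bounded {zero}  c h = z≤n
∑-bounded {suc n} c h = +-mono-≤ (h zero) (∑-bounded c (h ∘ suc))

∑-vanishes : ∀ {n} {f : Fin n → ℕ} → (∀ i → f i ≤ 0) → ∑[ i < n ] f i ≡ 0
∑-vanishes {n} h = n≤0⇒n≡0 (≤-trans (∑-bounded 0 h) (≤-reflexive (*-zeroʳ n)))

∑-term≤ : ∀ {n} (f : Fin n → ℕ) a → f a ≤ ∑[ i < n ] f i
∑-term≤ f zero    = m≤m+n _ _
∑-term≤ f (suc a) = ≤-trans (∑-term≤ (f ∘ suc) a) (m≤n+m _ _)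

∑-concentrated : ∀ {n} {f : Fin n → ℕ} (a : Fin n) c →
                 (∀ i → f i ≤ ifDec (i ≟ a) c) → ∑[ i < n ] f i ≤ c
∑-concentrated {suc n} {f} zero c h = begin
  f zero + ∑[ i < n ] f (suc i)  ≤⟨ +-monoʳ-≤ (f zero) (≤-reflexive (∑-vanishes (h ∘ suc))) ⟩
  f zero + 0                     ≡⟨ +-identityʳ (f zero) ⟩
  f zero                         ≤⟨ h zero ⟩
  c                              ∎
  where open ≤-Reasoning
∑-concentrated {suc n} (suc a) c h =
  +-mono-≤ (h zero) (∑-concentrated a c λ i →
    ≤-trans (h (suc i)) (ifDec-mono (suc i ≟ suc a) (i ≟ a) suc-injective c))

∑-fibres : ∀ {m n} {f : Fin m → Fin n → ℕ} (φ : Fin n → Fin m) (g : Fin n → ℕ) →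
           (∀ a c → f a c ≤ ifDec (a ≟ φ c) (g c)) →
           ∑[ a < m ] ∑[ c < n ] f a c ≤ ∑[ c < n ] g c
∑-fibres {f = f} φ g h = begin
  ∑[ a < _ ] ∑[ c < _ ] f a c  ≡⟨ ∑-comm f ⟩
  ∑[ c < _ ] ∑[ a < _ ] f a c  ≤⟨ ∑-mono-≤ (λ c → ∑-concentrated (φ c) (g c) (λ a → h a c)) ⟩
  ∑[ c < _ ] g c               ∎
  where open ≤-Reasoning

count : ∀ n {P : Fin n → Set} (P? : ∀ x → Dec (P x)) →
        length (filter P? (allFin n)) ≡ ∑[ x < n ] ifDec (P? x) 1
count n P? = trans (length-as-sum (allFin n)) (sumFin≡∑ n (λ x → ifDec (P? x) 1))
  where
  length-as-sum : ∀ xs → length (filter P? xs) ≡ sumList (map (λ x → ifDec (P? x) 1) xs)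
  length-as-sum []       = refl
  length-as-sum (x ∷ xs) with P? x
  ... | yes _ = cong suc (length-as-sum xs)
  ... | no _  = length-as-sum xs

module _ {n : ℕ} where
  ∑⁴ : (Fin n → Fin n → Fin n → Fin n → ℕ) → ℕ
  ∑⁴ f = ∑[ a < n ] ∑[ b < n ] ∑[ c < n ] ∑[ d < n ] f a b c d

  ∑⁴-distrib-+ : ∀ f g → ∑⁴ (λ a b c d → f a b c d + g a b c d) ≡ ∑⁴ f + ∑⁴ g
  ∑⁴-distrib-+ f g =
    trans (sum-cong-≗ λ a →
      trans (sum-cong-≗ λ b →
        trans (sum-cong-≗ λ c → ∑-distrib-+ (f a b c) (g a b c))
              (∑-distrib-+ (∑¹ f a b) (∑¹ g a b)))
            (∑-distrib-+ (∑² f a) (∑² g a)))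
          (∑-distrib-+ (∑³ f) (∑³ g))
    where
    ∑¹ : (Fin n → Fin n → Fin n → Fin n → ℕ) → Fin n → Fin n → Fin n → ℕ
    ∑¹ h a b c = ∑[ d < n ] h a b c d
    ∑² : (Fin n → Fin n → Fin n → Fin n → ℕ) → Fin n → Fin n → ℕ
    ∑² h a b = ∑[ c < n ] ∑¹ h a b c
    ∑³ : (Fin n → Fin n → Fin n → Fin n → ℕ) → Fin n → ℕ
    ∑³ h a = ∑[ b < n ] ∑² h a b
  ∑⁴-comm-∑ : ∀ {m} (f : Fin n → Fin n → Fin n → Fin n → Fin m → ℕ) →
              ∑⁴ (λ a b c d → ∑[ w < m ] f a b c d w) ≡ ∑[ w < m ] ∑⁴ (λ a b c d → f a b c d w)
  ∑⁴-comm-∑ {m} f =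
    trans (sum-cong-≗ λ a →
      trans (sum-cong-≗ λ b →
        trans (sum-cong-≗ λ c → ∑-comm (f a b c))
              (∑-comm (λ c w → ∑[ d < n ] f a b c d w)))
            (∑-comm (λ b w → ∑[ c < n ] ∑[ d < n ] f a b c d w)))
          (∑-comm (λ a w → ∑[ b < n ] ∑[ c < n ] ∑[ d < n ] f a b c d w))

  ∑⁴-swap-pairs : ∀ f → ∑⁴ (λ a b c d → f b a d c) ≡ ∑⁴ f
  ∑⁴-swap-pairs f =
    trans (sum-cong-≗ λ a → sum-cong-≗ λ b → ∑-comm (λ c d → f b a d c))
          (∑-comm (λ a b → ∑[ d < n ] ∑[ c < n ] f b a d c))

iter-shift : ∀ {A : Set} (f : A → A) k x → iter f k (f x) ≡ iter f (suc k) x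
iter-shift f zero    x = refl
iter-shift f (suc k) x = cong f (iter-shift f k x)

module Ancestors {n : ℕ} (T : RTree n) where
  private
    p : Fin n → Fin n
    p = parent T
    d : Fin n → ℕ
    d = depth T

  root-unique : ∀ x → d x ≡ 0 → x ≡ root T
  root-unique x e with x ≟ root T
  ... | yes x≡r = x≡r
  ... | no x≢r with trans (sym e) (depth-step T x x≢r)
  ... | ()

  nonroot : ∀ x → 0 < d x → x ≢ root T
  nonroot x lt x≡r = <⇒≢ lt (sym (trans (cong d x≡r) (depth-root T)))

  child-depth : ∀ {u c} → IsChild T u c → d c ≡ suc (d u)
  child-depth (nr , pc) = trans (depth-step T _ nr) (cong (suc ∘ d) pc)

  depth-iter : ∀ k x → k ≤ d x → d (iter p k x) + k ≡ d x
  depth-iter zero    x _  = +-identityʳ _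
  depth-iter (suc k) x le = trans (+-suc (d (p y)) k) (trans (cong (_+ k) (sym y-step)) ih)
    where
    y : Fin n
    y = iter p k x
    ih : d y + k ≡ d x
    ih = depth-iter k x (≤-trans (n≤1+n k) le)
    y-step : d y ≡ suc (d (p y))
    y-step = depth-step T y (nonroot y (+-cancelʳ-< k 0 (d y) (subst (k <_) (sym ih) le)))

  InSub-intro : ∀ {u w} k → k ≤ d w → iter p k w ≡ u → InSub T u w
  InSub-intro k le eq = applyUpTo⁺ id eq (s≤s le)

  InSub-elim : ∀ {u w} → InSub T u w → ∃[ k ] (k ≤ d w × iter p k w ≡ u × d u + k ≡ d w)
  InSub-elim {u} {w} i with applyUpTo⁻ id i
  ... | k , s≤s le , eq = k , le , eq , trans (cong (λ z → d z + k) (sym eq)) (depth-iter k w le)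

  InSub-refl : ∀ w → InSub T w w
  InSub-refl w = InSub-intro 0 z≤n refl

  InSub-parent : ∀ {x w} → InSub T x w → x ≢ root T → InSub T (p x) w
  InSub-parent {x} {w} i nr with InSub-elim i
  ... | k , le , eq , de = InSub-intro (suc k) le′ (cong p eq)
    where
    le′ : suc k ≤ d w
    le′ = subst (suc k ≤_) (trans (cong (_+ k) (sym (depth-step T x nr))) de) (s≤s (m≤n+m k _))

  InSub-up : ∀ {a x} → InSub T a x → a ≢ x → x ≢ root T → InSub T a (p x)
  InSub-up {a} {x} i ne nr with InSub-elim i
  ... | zero  , le , eq , de = ⊥-elim (ne (sym eq))
  ... | suc k , le , eq , de = InSub-intro k (≤-pred (subst (suc k ≤_) (depth-step T x nr) le))
                                             (trans (iter-shift p k x) eq)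

  anc-at : ∀ {b w} → InSub T b w → b ≡ iter p (d w ∸ d b) w
  anc-at {b} {w} i with InSub-elim i
  ... | k , _ , eq , de =
    trans (sym eq) (cong (λ z → iter p z w) (sym (trans (cong (_∸ d b) (sym de)) (m+n∸m≡n (d b) k))))

  anc-unique : ∀ {a b w} → InSub T a w → InSub T b w → d a ≡ d b → a ≡ b
  anc-unique {w = w} ia ib e =
    trans (anc-at ia) (trans (cong (λ z → iter p (d w ∸ z) w) e) (sym (anc-at ib)))

  -- The root is its own parent, hence its only ancestor.
  iter-root : ∀ k → iter p k (root T) ≡ root T
  iter-root zero    = refl
  iter-root (suc k) = trans (cong p (iter-root k)) (parent-root T)

  InSub-root : ∀ {a} → InSub T a (root T) → a ≡ root T
  InSub-root i with InSub-elim i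
  ... | k , _ , eq , _ = trans (sym eq) (iter-root k)

module HeavyPaths {n : ℕ} (T : RTree n) (h : Fin n → Fin n) (H : IsHeavyChoice T h) where
  open Ancestors T
  private
    p : Fin n → Fin n
    p = parent T
    d : Fin n → ℕ
    d = depth T

  Light : Fin n → Set
  Light a = (a ≢ root T) × (a ≢ h (p a))

  Light? : ∀ a → Dec (Light a)
  Light? a = ¬? (a ≟ root T) ×-dec ¬? (a ≟ h (p a))

  -- the number of light ancestors of w (w itself included)
  lightDepth : Fin n → ℕ
  lightDepth w = ∑[ a < n ] ifDec (Light? a ×-dec inSub? T a w) 1

  inSubtree : Fin n → Fin n → ℕ
  inSubtree x w = ifDec (inSub? T x w) 1

  size-as-sum : ∀ x → size T x ≡ ∑[ w < n ] inSubtree x w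
  size-as-sum x = count n (inSub? T x)

  size≤n : ∀ x → size T x ≤ n
  size≤n x = ≤-trans (length-filter (inSub? T x) (allFin n)) (≤-reflexive (length-tabulate id))

  size-pos : ∀ x → 1 ≤ size T x
  size-pos x = subst (1 ≤_) (sym (size-as-sum x))
    (≤-trans (≤-reflexive (sym (ifDec-yes (inSub? T x x) (InSub-refl x) 1))) (∑-term≤ (inSubtree x) x))

  size-parent : ∀ x → x ≢ root T → size T x ≤ size T (p x)
  size-parent x nr = subst₂ _≤_ (sym (size-as-sum x)) (sym (size-as-sum (p x)))
    (∑-mono-≤ λ w → ifDec-mono (inSub? T x w) (inSub? T (p x) w) (λ i → InSub-parent i nr) 1)

  -- A light child x and the heavy child c of its parent have disjoint subtrees inside
  -- T|p(x), and |T|x| ≤ |T|c|; hence 2 |T|x| ≤ |T|p(x)|.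
  light-half : ∀ x → Light x → 2 * size T x ≤ size T (p x)
  light-half x (nr , nh) = begin
    2 * size T x             ≡⟨ cong (size T x +_) (+-identityʳ (size T x)) ⟩
    size T x + size T x      ≤⟨ +-monoʳ-≤ (size T x) (proj₂ heavy) ⟩
    size T x + size T c      ≡⟨ cong₂ _+_ (size-as-sum x) (size-as-sum c) ⟩
    ∑[ w < n ] inSubtree x w + ∑[ w < n ] inSubtree c w   ≡⟨ ∑-distrib-+ (inSubtree x) (inSubtree c) ⟨
    ∑[ w < n ] (inSubtree x w + inSubtree c w)            ≤⟨ ∑-mono-≤ disjoint ⟩
    ∑[ w < n ] inSubtree (p x) w                          ≡⟨ size-as-sum (p x) ⟨
    size T (p x)             ∎
    where
    open ≤-Reasoning
    c : Fin n
    c = h (p x)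
    heavy : IsChild T (p x) c × (size T x ≤ size T c)
    heavy = H (p x) x (nr , refl)
    c-child : IsChild T (p x) c
    c-child = proj₁ heavy
    disjoint : ∀ w → inSubtree x w + inSubtree c w ≤ inSubtree (p x) w
    disjoint w with inSub? T x w | inSub? T c w
    ... | yes ix | yes ic = ⊥-elim (nh (anc-unique ix ic
                              (trans (child-depth (nr , refl)) (sym (child-depth c-child)))))
    ... | yes ix | no _   = ≤-reflexive (sym (ifDec-yes (inSub? T (p x) w) (InSub-parent ix nr) 1))
    ... | no _   | yes ic = ≤-reflexive (sym (ifDec-yes (inSub? T (p x) w)
                              (subst (λ z → InSub T z w) (proj₂ c-child) (InSub-parent ic (proj₁ c-child))) 1))
    ... | no _   | no _   = z≤n

  -- The root is not light and is its own only ancestor.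
  lightDepth-root : lightDepth (root T) ≡ 0
  lightDepth-root = ∑-vanishes λ a →
    ifDec-elim (Light? a ×-dec inSub? T a (root T)) λ { ((nr , _) , i) → ⊥-elim (nr (InSub-root i)) }

  lightDepth-step : ∀ x → x ≢ root T → lightDepth x ≤ ifDec (Light? x) 1 + lightDepth (p x)
  lightDepth-step x nr = begin
    lightDepth x                                          ≤⟨ ∑-mono-≤ split ⟩
    ∑[ a < n ] (ifDec (a ≟ x) (ifDec (Light? x) 1) + up a) ≡⟨ ∑-distrib-+ _ up ⟩
    ∑[ a < n ] ifDec (a ≟ x) (ifDec (Light? x) 1) + lightDepth (p x)
                                                          ≤⟨ +-mono-≤ (∑-concentrated x _ (λ _ → ≤-refl)) ≤-refl ⟩
    ifDec (Light? x) 1 + lightDepth (p x)                 ∎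
    where
    open ≤-Reasoning
    up : Fin n → ℕ
    up a = ifDec (Light? a ×-dec inSub? T a (p x)) 1
    split : ∀ a → ifDec (Light? a ×-dec inSub? T a x) 1 ≤ ifDec (a ≟ x) (ifDec (Light? x) 1) + up a
    split a with Light? a ×-dec inSub? T a x
    ... | no _ = z≤n
    ... | yes (la , i) with a ≟ x
    ...   | yes refl = ≤-trans (≤-reflexive (sym (ifDec-yes (Light? a) la 1))) (m≤m+n _ _)
    ...   | no a≢x   = ≤-trans (≤-reflexive (sym (ifDec-yes (Light? a ×-dec inSub? T a (p x))
                                                            (la , InSub-up i a≢x nr) 1))) (m≤n+m _ _)

  size-step : ∀ x → x ≢ root T → 2 ^ ifDec (Light? x) 1 * size T x ≤ size T (p x)
  size-step x nr with Light? x
  ... | yes l = light-half x l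
  ... | no _  = ≤-trans (≤-reflexive (+-identityʳ (size T x))) (size-parent x nr)

  heavy-path : ∀ k x → d x ≡ k → 2 ^ lightDepth x * size T x ≤ n
  heavy-path zero x e rewrite root-unique x e | lightDepth-root =
    ≤-trans (≤-reflexive (+-identityʳ _)) (size≤n (root T))
  heavy-path (suc k) x e = begin
    2 ^ lightDepth x * size T x                  ≤⟨ *-monoˡ-≤ (size T x) (^-monoʳ-≤ 2 (lightDepth-step x nr)) ⟩
    2 ^ (ℓ + lightDepth (p x)) * size T x        ≡⟨ cong (_* size T x) (^-distribˡ-+-* 2 ℓ (lightDepth (p x))) ⟩
    2 ^ ℓ * 2 ^ lightDepth (p x) * size T x      ≡⟨ cong (_* size T x) (*-comm (2 ^ ℓ) _) ⟩
    2 ^ lightDepth (p x) * 2 ^ ℓ * size T x      ≡⟨ *-assoc (2 ^ lightDepth (p x)) _ _ ⟩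
    2 ^ lightDepth (p x) * (2 ^ ℓ * size T x)    ≤⟨ *-monoʳ-≤ (2 ^ lightDepth (p x)) (size-step x nr) ⟩
    2 ^ lightDepth (p x) * size T (p x)          ≤⟨ heavy-path k (p x) parent-depth ⟩
    n                                            ∎
    where
    open ≤-Reasoning
    nr : x ≢ root T
    nr = nonroot x (subst (0 <_) (sym e) (s≤s z≤n))
    parent-depth : d (p x) ≡ k
    parent-depth = ℕₚ.suc-injective (trans (sym (depth-step T x nr)) e)
    ℓ : ℕ
    ℓ = ifDec (Light? x) 1

  lightDepth≤log : ∀ w → lightDepth w ≤ ⌊log₂ n ⌋
  lightDepth≤log w = subst (_≤ ⌊log₂ n ⌋) (⌊log₂[2^n]⌋≡n (lightDepth w)) (⌊log₂⌋-mono-≤ 2^ℓ≤n)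
    where
    2^ℓ≤n : 2 ^ lightDepth w ≤ n
    2^ℓ≤n = ≤-trans (≤-trans (≤-reflexive (sym (*-identityʳ _))) (*-monoʳ-≤ (2 ^ lightDepth w) (size-pos w)))
                    (heavy-path (d w) w refl)

module _ {n : ℕ} (T₁ T₂ : RTree n) where
  commonNodes : Fin n → Fin n → ℕ
  commonNodes x y = ∑[ w < n ] ifDec (inSub? T₁ x w ×-dec inSub? T₂ y w) 1

  -- An isomorphism T₁|x → T₂|y maps into T₂|y, so each of its fixed points is common.
  fixCount≤commonNodes : ∀ {x y μ} → IsIso T₁ T₂ x y μ → fixCount T₁ T₂ x μ ≤ commonNodes x y
  fixCount≤commonNodes {x} {y} {μ} iso = subst (_≤ commonNodes x y)
    (sym (count n (λ w → inSub? T₁ x w ×-dec (μ w ≟ w))))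
    (∑-mono-≤ λ w → ifDec-mono (inSub? T₁ x w ×-dec (μ w ≟ w)) (inSub? T₁ x w ×-dec inSub? T₂ y w)
                      (λ { (i , fixed) → i , subst (InSub T₂ y) fixed (IsIso.into iso w i) }) 1)

  -- γ(x,y) is attained by an isomorphism, so it is at most |T₁|x ∩ T₂|y|.
  γ≤commonNodes : ∀ {γ} → IsGamma T₁ T₂ γ → ∀ {x y} → Iso T₁ T₂ x y → γ x y ≤ commonNodes x y
  γ≤commonNodes isγ {x} {y} iso with proj₁ (proj₂ (isγ x y) iso)
  ... | μ , μ-iso , fix≡γ = subst (_≤ commonNodes x y) fix≡γ (fixCount≤commonNodes μ-iso)

-- Charging common nodes to light children
module _ {n : ℕ} (T T′ : RTree n) (h : Fin n → Fin n) where
  Charged : Fin n → Fin n → Fin n → Fin n → Fin n → Set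
  Charged a b a′ b′ w = IsChild T a a′ × IsChild T′ b b′ × depth T a ≡ depth T′ b
                        × a′ ≢ h a × InSub T a′ w × InSub T′ b′ w

  charged? : ∀ a b a′ b′ w → Dec (Charged a b a′ b′ w)
  charged? a b a′ b′ w = isChild? T a a′ ×-dec isChild? T′ b b′ ×-dec (depth T a ℕ.≟ depth T′ b)
                         ×-dec ¬? (a′ ≟ h a) ×-dec inSub? T a′ w ×-dec inSub? T′ b′ w

  charge : Fin n → Fin n → Fin n → Fin n → Fin n → ℕ
  charge a b a′ b′ w = ifDec (charged? a b a′ b′ w) 1

  -- The tuples charging w are determined by the light ancestor a′ of w, so w receives at
  -- most lightDepth(w) charges.
  charges-at-node : (H : IsHeavyChoice T h) → ∀ w →
                    ∑⁴ (λ a b a′ b′ → charge a b a′ b′ w) ≤ HeavyPaths.lightDepth T h H w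
  charges-at-node H w = begin
    ∑⁴ (λ a b a′ b′ → charge a b a′ b′ w)
      ≤⟨ ∑-mono-≤ (λ a → ∑-fibres β _ (λ b a′ → ∑-concentrated (α a′) _ (pinned a b a′))) ⟩
    ∑[ a < n ] ∑[ a′ < n ] ifDec (a ≟ parent T a′) (light-anc a′)
      ≤⟨ ∑-fibres (parent T) light-anc (λ _ _ → ≤-refl) ⟩
    lightDepth w ∎
    where
    open ≤-Reasoning
    open HeavyPaths T h H using (Light; Light?; lightDepth)
    module A  = Ancestors T
    module A′ = Ancestors T′
    light-anc : Fin n → ℕ
    light-anc a′ = ifDec (Light? a′ ×-dec inSub? T a′ w) 1
    -- the ancestor of w in T′ at the depth of a′, and its parent
    α β : Fin n → Fin n
    α a′ = iter (parent T′) (depth T′ w ∸ depth T a′) w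
    β a′ = parent T′ (α a′)
    -- in a charged tuple, b′ is the ancestor of w at depth(b′) = depth(b) + 1 = depth(a′)
    b′≡α : ∀ {a b a′ b′} → IsChild T a a′ → IsChild T′ b b′ → depth T a ≡ depth T′ b →
           InSub T′ b′ w → b′ ≡ α a′
    b′≡α {a′ = a′} ca cb de i′ =
      trans (A′.anc-at i′) (cong (λ z → iter (parent T′) (depth T′ w ∸ z) w)
      (trans (A′.child-depth cb) (trans (cong suc (sym de)) (sym (A.child-depth ca)))))
    light : ∀ {a a′} → IsChild T a a′ → a′ ≢ h a → Light a′
    light (nr , pa) nh = nr , λ e → nh (trans e (cong h pa))
    pinned : ∀ a b a′ b′ → charge a b a′ b′ w ≤
             ifDec (b′ ≟ α a′) (ifDec (b ≟ β a′) (ifDec (a ≟ parent T a′) (light-anc a′)))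
    pinned a b a′ b′ = ifDec-elim (charged? a b a′ b′ w) λ { (ca , cb , de , nh , i , i′) →
      let b′-pinned = b′≡α ca cb de i′ in
      ≤-reflexive (sym (
        trans (ifDec-yes (b′ ≟ α a′) b′-pinned _)
       (trans (ifDec-yes (b ≟ β a′) (trans (sym (proj₂ cb)) (cong (parent T′) b′-pinned)) _)
       (trans (ifDec-yes (a ≟ parent T a′) (sym (proj₂ ca)) _)
              (ifDec-yes (Light? a′ ×-dec inSub? T a′ w) (light ca nh , i) 1))))) }

  all-charges : IsHeavyChoice T h →
                ∑⁴ (λ a b a′ b′ → ∑[ w < n ] charge a b a′ b′ w) ≤ n * ⌊log₂ n ⌋
  all-charges H = begin
    ∑⁴ (λ a b a′ b′ → ∑[ w < n ] charge a b a′ b′ w)  ≡⟨ ∑⁴-comm-∑ charge ⟩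
    ∑[ w < n ] ∑⁴ (λ a b a′ b′ → charge a b a′ b′ w)  ≤⟨ ∑-bounded ⌊log₂ n ⌋ bound ⟩
    n * ⌊log₂ n ⌋                                     ∎
    where
    open ≤-Reasoning
    bound : ∀ w → ∑⁴ (λ a b a′ b′ → charge a b a′ b′ w) ≤ ⌊log₂ n ⌋
    bound w = ≤-trans (charges-at-node H w) (HeavyPaths.lightDepth≤log T h H w)

-- Each non-special edge weight is covered by charges
module _ {n : ℕ} (T₁ T₂ : RTree n)
         (iso? : ∀ x y → Dec (Iso T₁ T₂ x y))
         (γ : Fin n → Fin n → ℕ) (isγ : IsGamma T₁ T₂ γ)
         (h₁ h₂ : Fin n → Fin n) where

  nonSpecialEdge? : ∀ u v u′ v′ → Dec (IsChild T₁ u u′ × IsChild T₂ v v′ × Iso T₁ T₂ u′ v′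
                                       × 0 < γ u′ v′ × ¬ ((u′ ≡ h₁ u) × (v′ ≡ h₂ v)))
  nonSpecialEdge? u v u′ v′ = isChild? T₁ u u′ ×-dec isChild? T₂ v v′ ×-dec iso? u′ v′
                              ×-dec (0 ℕ.<? γ u′ v′) ×-dec ¬? ((u′ ≟ h₁ u) ×-dec (v′ ≟ h₂ v))

  edgeWeight : Fin n → Fin n → Fin n → Fin n → ℕ
  edgeWeight u v u′ v′ = ifDec (nonSpecialEdge? u v u′ v′) (γ u′ v′)

  -- A common node of a non-special edge is charged in T₁ if u′ is not heavy, else in T₂.
  edgeWeight≤charges : ∀ u v u′ v′ → level T₁ u ≡ level T₂ v →
    edgeWeight u v u′ v′ ≤ ∑[ w < n ] charge T₁ T₂ h₁ u v u′ v′ w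
                         + ∑[ w < n ] charge T₂ T₁ h₂ v u v′ u′ w
  edgeWeight≤charges u v u′ v′ lv =
    ifDec-elim (nonSpecialEdge? u v u′ v′) λ { (cu , cv , iso , _ , nonSpecial) →
      ≤-trans (γ≤commonNodes T₁ T₂ isγ iso) (common≤charges cu cv nonSpecial) }
    where
    common≤charges : IsChild T₁ u u′ → IsChild T₂ v v′ → ¬ ((u′ ≡ h₁ u) × (v′ ≡ h₂ v)) →
      commonNodes T₁ T₂ u′ v′ ≤ ∑[ w < n ] charge T₁ T₂ h₁ u v u′ v′ w
                              + ∑[ w < n ] charge T₂ T₁ h₂ v u v′ u′ w
    common≤charges cu cv nonSpecial with u′ ≟ h₁ u
    ... | yes u′-heavy = ≤-trans (∑-mono-≤ λ w → ifDec-mono (inSub? T₁ u′ w ×-dec inSub? T₂ v′ w) _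
            (λ { (i₁ , i₂) → cv , cu , sym lv , (λ v′-heavy → nonSpecial (u′-heavy , v′-heavy))
                           , i₂ , i₁ }) 1)
          (m≤n+m _ _)
    ... | no u′-light  = ≤-trans (∑-mono-≤ λ w → ifDec-mono (inSub? T₁ u′ w ×-dec inSub? T₂ v′ w) _
            (λ { (i₁ , i₂) → cu , cv , lv , u′-light , i₁ , i₂ }) 1)
          (m≤m+n _ _)

  totalNonSpecial≤ : IsHeavyChoice T₁ h₁ → IsHeavyChoice T₂ h₂ →
                     totalNonSpecial T₁ T₂ iso? γ h₁ h₂ ≤ 2 * n * ⌊log₂ n ⌋
  totalNonSpecial≤ H₁ H₂ = begin
    totalNonSpecial T₁ T₂ iso? γ h₁ h₂
      ≤⟨ sumFin-≤ n (λ u → sumFin-≤ n λ v →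
           ifDec-elim (ℕ._≟_ (level T₁ u) (level T₂ v) ×-dec iso? u v) λ (lv , _) →
             sumFin-≤ n λ u′ → sumFin-≤ n λ v′ → edgeWeight≤charges u v u′ v′ lv) ⟩
    ∑⁴ (λ u v u′ v′ → charges₁ u v u′ v′ + charges₂ v u v′ u′)
      ≡⟨ ∑⁴-distrib-+ charges₁ (λ u v u′ v′ → charges₂ v u v′ u′) ⟩
    ∑⁴ charges₁ + ∑⁴ (λ u v u′ v′ → charges₂ v u v′ u′)
      ≡⟨ cong (∑⁴ charges₁ +_) (∑⁴-swap-pairs charges₂) ⟩
    ∑⁴ charges₁ + ∑⁴ charges₂
      ≤⟨ +-mono-≤ (all-charges T₁ T₂ h₁ H₁) (all-charges T₂ T₁ h₂ H₂) ⟩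
    n * ⌊log₂ n ⌋ + n * ⌊log₂ n ⌋
      ≡⟨ cong (n * ⌊log₂ n ⌋ +_) (+-identityʳ (n * ⌊log₂ n ⌋)) ⟨
    2 * (n * ⌊log₂ n ⌋)
      ≡⟨ *-assoc 2 n ⌊log₂ n ⌋ ⟨
    2 * n * ⌊log₂ n ⌋ ∎
    where
    open ≤-Reasoning
    charges₁ charges₂ : Fin n → Fin n → Fin n → Fin n → ℕ
    charges₁ u v u′ v′ = ∑[ w < n ] charge T₁ T₂ h₁ u v u′ v′ w
    charges₂ v u v′ u′ = ∑[ w < n ] charge T₂ T₁ h₂ v u v′ u′ w

-- The theorem, with C = 2 and N = 0.
lemma1 : ∃[ C ] ∃[ N ] (∀ (n : ℕ) → N ≤ n → (T₁ T₂ : RTree n)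
           → (iso? : ∀ x y → Dec (Iso T₁ T₂ x y))
           → (γ : Fin n → Fin n → ℕ) → IsGamma T₁ T₂ γ
           → (h₁ h₂ : Fin n → Fin n)
           → IsHeavyChoice T₁ h₁ → IsHeavyChoice T₂ h₂ → HeavyCompatible T₁ T₂ h₁ h₂
           → totalNonSpecial T₁ T₂ iso? γ h₁ h₂ ≤ C * n * ⌊log₂ n ⌋)
lemma1 = 2 , 0 , λ n _ T₁ T₂ iso? γ isγ h₁ h₂ H₁ H₂ _ →
  totalNonSpecial≤ T₁ T₂ iso? γ isγ h₁ h₂ H₁ H₂
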